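{- Let $k\geq 2$ and let $G$ be a total $k$-uniform graph. If $v_1v_2$ is an edge of $G$, then the graph $G\setminus (N[v_1]\cup N[v_2])$ (obtained by deleting all vertices of $N[v_1]\cup N[v_2]$) has no isolated vertices.
   Context: All graphs are finite and simple. $N(v)$ is the set of neighbors of $v$ and $N[v]=N(v)\cup\{v\}$. For a graph $G$ with no isolated vertices, a set $A\subseteq V(G)$ is a total dominating set if every vertex of $G$ has a neighbor in $A$; $\gamma_t(G)$ is the minimum size of a total dominating set. A sequence $(v_1,\dots,v_m)$ of distinct vertices is legal if $N(v_i)\setminus\bigcup_{j=1}^{i-1}N(v_j)\neq\emptyset$ for every $i\in\{2,\dots,m\}$; it is a total dominating sequence if moreover $\{v_1,\dots,v_m\}$ is a total dominating set. $\gamma_{gr}^t(G)$ is the maximum length of a total dominating sequence. A graph $G$ with no isolated vertices is total $k$-uniform if $\gamma_t(G)=\gamma_{gr}^t(G)=k$. -}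

module Defs where

open import Data.Nat using (ℕ; _≤_; _<_)
open import Data.Fin using (Fin)
open import Data.Fin.Subset using (Subset; _∈_; _∉_; ∣_∣)
open import Data.List using (List; []; _∷_; length)
open import Data.List.Relation.Unary.Unique.Propositional using (Unique)
open import Data.List.Relation.Unary.Any using (Any)
open import Data.List.Relation.Unary.All using (All)
open import Data.Product using (Σ; ∃; _×_; _,_)
open import Data.Sum using (_⊎_)
open import Relation.Nullary using (¬_; Dec)
open import Relation.Binary.PropositionalEquality using (_≡_)
open import Data.Unit using (⊤)

record Graph (n : ℕ) : Set₁ where
  field
    Adj     : Fin n → Fin n → Set
    adj?    : ∀ u v → Dec (Adj u v)
    sym     : ∀ {u v} → Adj u v → Adj v u
    irrefl  : ∀ {u} → ¬ Adj u u

module _ {n : ℕ} (G : Graph n) where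
  open Graph G

  NoIsolated : Set
  NoIsolated = ∀ u → ∃ λ w → Adj u w

  IsTDS : Subset n → Set
  IsTDS A = ∀ u → ∃ λ w → w ∈ A × Adj u w

  InSomeN : List (Fin n) → Fin n → Set
  InSomeN vs u = Any (λ v → Adj v u) vs

  -- legality: N(v_i) \ ⋃_{j<i} N(v_j) ≠ ∅ for i ≥ 2.
  -- The list is stored in order v_1, v_2, ...; `prev` are the earlier vertices.
  LegalFrom : List (Fin n) → List (Fin n) → Set
  LegalFrom prev [] = ⊤
  LegalFrom [] (v ∷ vs) = LegalFrom (v ∷ []) vs
  LegalFrom prev@(_ ∷ _) (v ∷ vs) =
    (∃ λ u → Adj v u × ¬ InSomeN prev u) × LegalFrom (v ∷ prev) vs

  IsLegal : List (Fin n) → Set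
  IsLegal vs = Unique vs × LegalFrom [] vs

  IsTDSeq : List (Fin n) → Set
  IsTDSeq vs = IsLegal vs × (∀ u → ∃ λ w → Any (w ≡_) vs × Adj u w)

  GammaT≡ : ℕ → Set
  GammaT≡ k = (∃ λ A → IsTDS A × ∣ A ∣ ≡ k) × (∀ A → IsTDS A → k ≤ ∣ A ∣)

  GammaGrT≡ : ℕ → Set
  GammaGrT≡ k = (∃ λ vs → IsTDSeq vs × length vs ≡ k)
              × (∀ vs → IsTDSeq vs → length vs ≤ k)

  TotalUniform : ℕ → Set
  TotalUniform k = NoIsolated × GammaT≡ k × GammaGrT≡ k

  InClosedN : Fin n → Fin n → Set
  InClosedN v u = (u ≡ v) ⊎ Adj v u

  Outside : Fin n → Fin n → Fin n → Set
  Outside v₁ v₂ u = ¬ InClosedN v₁ u × ¬ InClosedN v₂ u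

  DeletionNoIsolated : Fin n → Fin n → Set
  DeletionNoIsolated v₁ v₂ =
    ∀ u → Outside v₁ v₂ u → ∃ λ w → Outside v₁ v₂ w × Adj u w

-- Suppose some vertex u outside N[v₁] ∪ N[v₂] had all its neighbours in N[v₁] ∪ N[v₂];
-- since u is adjacent to neither v₁ nor v₂, those neighbours lie in N(v₁) ∪ N(v₂).
-- The sequence (u, v₁, v₂) is legal (v₁ newly dominates v₂, and v₂ newly dominates v₁),
-- and greedily extends to a total dominating sequence (u, v₁, v₂, r₁, …, rₘ). Dropping u
-- still leaves a total dominating set, because everything u dominates is dominated by
-- v₁ or v₂. Hence γ_t(G) ≤ m + 2 < m + 3 ≤ γ_gr^t(G), contradicting total uniformity.
module Submission where

open import Defs
open import Data.Nat using (ℕ; zero; suc; _+_; _≤_; _<_; s≤s; z≤n)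
open import Data.Nat.Properties
  using (≤-trans; ≤-reflexive; +-suc; +-identityʳ; +-monoʳ-≤; n≤1+n; m≤n+m; ≤⇒≯; <⇒≱; ≮⇒≥; module ≤-Reasoning)
open import Data.Fin using (Fin; toℕ; zero; suc) renaming (_≟_ to _≟ᶠ_)
open import Data.Fin.Properties using (pigeonhole; all?; any?; ¬∀⟶∃¬)
open import Data.Fin.Subset using (Subset; ⁅_⁆; _∪_; ∣_∣; inside; outside) renaming (_∈_ to _∈ₛ_; ⊥ to ∅)
open import Data.Fin.Subset.Properties using (∣⊥∣≡0; ∣⁅x⁆∣≡1; x∈⁅x⁆; x∈p∪q⁺)
open import Data.Vec using ([]; _∷_)
open import Data.List using (List; []; _∷_; length; lookup; _ʳ++_)
open import Data.List.Relation.Unary.Unique.Propositional using (Unique)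
open import Data.List.Relation.Unary.AllPairs using ([]; _∷_)
open import Data.List.Relation.Unary.Any using (here; there)
import Data.List.Relation.Unary.Any as Any
open import Data.List.Relation.Unary.Any.Properties using (reverseAcc⁺)
open import Data.List.Relation.Unary.All as All using (All; []; _∷_)
open import Data.List.Relation.Unary.All.Properties using (¬Any⇒All¬)
open import Data.List.Membership.Propositional using (_∈_; _∉_; find; lose)
open import Data.List.Membership.Propositional.Properties using (∈-lookup)
open import Data.List.Relation.Binary.Subset.Propositional using (_⊆_)
open import Data.Product using (∃; _×_; _,_; proj₁; proj₂)
open import Data.Sum using (_⊎_; inj₁; inj₂; swap)
open import Data.Empty using (⊥-elim)
open import Data.Unit using (tt)
open import Function using (_∘_)
open import Relation.Nullary using (¬_; Dec; yes; no; ¬?; _×-dec_; _⊎-dec_)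
open import Relation.Nullary.Decidable using (decidable-stable)
open import Relation.Binary.PropositionalEquality using (_≡_; _≢_; refl; sym; cong; subst)

∣p∪q∣≤∣p∣+∣q∣ : ∀ {n} (p q : Subset n) → ∣ p ∪ q ∣ ≤ ∣ p ∣ + ∣ q ∣
∣p∪q∣≤∣p∣+∣q∣ []            []            = z≤n
∣p∪q∣≤∣p∣+∣q∣ (inside ∷ p)  (inside ∷ q)  =
  s≤s (≤-trans (∣p∪q∣≤∣p∣+∣q∣ p q) (+-monoʳ-≤ ∣ p ∣ (n≤1+n ∣ q ∣)))
∣p∪q∣≤∣p∣+∣q∣ (inside ∷ p)  (outside ∷ q) = s≤s (∣p∪q∣≤∣p∣+∣q∣ p q)
∣p∪q∣≤∣p∣+∣q∣ (outside ∷ p) (inside ∷ q)  =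
  ≤-trans (s≤s (∣p∪q∣≤∣p∣+∣q∣ p q)) (≤-reflexive (sym (+-suc ∣ p ∣ ∣ q ∣)))
∣p∪q∣≤∣p∣+∣q∣ (outside ∷ p) (outside ∷ q) = ∣p∪q∣≤∣p∣+∣q∣ p q

fromList : ∀ {n} → List (Fin n) → Subset n
fromList []       = ∅
fromList (x ∷ xs) = ⁅ x ⁆ ∪ fromList xs

∣fromList∣≤length : ∀ {n} (xs : List (Fin n)) → ∣ fromList xs ∣ ≤ length xs
∣fromList∣≤length {n} []       = ≤-reflexive (∣⊥∣≡0 n)
∣fromList∣≤length (x ∷ xs) = begin
  ∣ ⁅ x ⁆ ∪ fromList xs ∣          ≤⟨ ∣p∪q∣≤∣p∣+∣q∣ ⁅ x ⁆ (fromList xs) ⟩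
  ∣ ⁅ x ⁆ ∣ + ∣ fromList xs ∣       ≡⟨ cong (_+ ∣ fromList xs ∣) (∣⁅x⁆∣≡1 x) ⟩
  suc ∣ fromList xs ∣               ≤⟨ s≤s (∣fromList∣≤length xs) ⟩
  suc (length xs)                   ∎
  where open ≤-Reasoning

∈⇒∈fromList : ∀ {n} {x : Fin n} {xs} → x ∈ xs → x ∈ₛ fromList xs
∈⇒∈fromList (here refl) = x∈p∪q⁺ (inj₁ (x∈⁅x⁆ _))
∈⇒∈fromList (there x∈xs) = x∈p∪q⁺ (inj₂ (∈⇒∈fromList x∈xs))

lookup-injective : ∀ {a} {A : Set a} {xs : List A} → Unique xs →
                   ∀ {i j} → toℕ i < toℕ j → lookup xs i ≢ lookup xs j
lookup-injective (x∉xs ∷ _)    {zero}  {suc j} _         eq = All.lookup x∉xs (∈-lookup j) eq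
lookup-injective (_ ∷ unique) {suc i} {suc j} (s≤s i<j) eq = lookup-injective unique i<j eq

unique⇒length≤ : ∀ {n} {xs : List (Fin n)} → Unique xs → length xs ≤ n
unique⇒length≤ {xs = xs} unique = ≮⇒≥ λ n<length →
  let i , j , i<j , eq = pigeonhole n<length (lookup xs)
  in lookup-injective unique i<j eq

All∉∷⇒All≢ : ∀ {a} {A : Set a} {v : A} {ps vs : List A} → All (_∉ v ∷ ps) vs → All (v ≢_) vs
All∉∷⇒All≢ = All.map λ w∉ v≡w → w∉ (here (sym v≡w))

module _ {n : ℕ} (G : Graph n) where
  open Graph G renaming (sym to adj-sym)

  DominatedBy : List (Fin n) → Fin n → Set
  DominatedBy vs z = ∃ λ w → w ∈ vs × Adj z w

  Dominates : List (Fin n) → Set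
  Dominates vs = ∀ z → DominatedBy vs z

  Dominates-mono : ∀ {xs ys} → xs ⊆ ys → Dominates xs → Dominates ys
  Dominates-mono xs⊆ys dom z with dom z
  ... | w , w∈xs , zw = w , xs⊆ys w∈xs , zw

  Dominates⇒IsTDS : ∀ {vs} → Dominates vs → IsTDS G (fromList vs)
  Dominates⇒IsTDS dom z with dom z
  ... | w , w∈vs , zw = w , ∈⇒∈fromList w∈vs , zw

  Dominates-drop : ∀ {u vs} → Dominates (u ∷ vs) →
                   (∀ z → Adj z u → DominatedBy vs z) → Dominates vs
  Dominates-drop dom byOthers z with dom z
  ... | w , here refl , zu = byOthers z zu
  ... | w , there w∈vs , zw = w , w∈vs , zw

  InSomeN? : ∀ vs x → Dec (InSomeN G vs x)
  InSomeN? vs x = Any.any? (λ v → adj? v x) vs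

  dominates? : ∀ vs → Dominates vs ⊎ ∃ λ x → ¬ InSomeN G vs x
  dominates? vs with all? (InSomeN? vs)
  ... | yes covered = inj₁ λ z → let w , w∈vs , wz = find (covered z) in w , w∈vs , adj-sym wz
  ... | no ¬covered = inj₂ (¬∀⟶∃¬ n (InSomeN G vs) (InSomeN? vs) ¬covered)

  fresh⇒∉ : ∀ {vs x y} → ¬ InSomeN G vs x → Adj y x → y ∉ vs
  fresh⇒∉ x-new yx y∈vs = x-new (lose y∈vs yx)

  Unique-∷-fresh : ∀ {vs x y} → Unique vs → ¬ InSomeN G vs x → Adj y x → Unique (y ∷ vs)
  Unique-∷-fresh {vs} unique x-new yx = ¬Any⇒All¬ vs (fresh⇒∉ x-new yx) ∷ unique

  LegalFrom-∷ : ∀ prev {x y rs} → ¬ InSomeN G prev x → Adj y x →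
                LegalFrom G (y ∷ prev) rs → LegalFrom G prev (y ∷ rs)
  LegalFrom-∷ []      _     _  legal = legal
  LegalFrom-∷ (_ ∷ _) x-new yx legal = (_ , yx , x-new) , legal

  LegalFrom⇒fresh : ∀ p ps vs → LegalFrom G (p ∷ ps) vs → All (_∉ p ∷ ps) vs × Unique vs
  LegalFrom⇒fresh p ps []       _ = [] , []
  LegalFrom⇒fresh p ps (v ∷ vs) ((x , vx , x-new) , legal)
    with LegalFrom⇒fresh v (p ∷ ps) vs legal
  ... | fresh , unique =
    fresh⇒∉ x-new vx ∷ All.map (_∘ there) fresh , All∉∷⇒All≢ fresh ∷ unique

  LegalFrom[]⇒Unique : ∀ vs → LegalFrom G [] vs → Unique vs
  LegalFrom[]⇒Unique []       _     = []
  LegalFrom[]⇒Unique (v ∷ vs) legal with LegalFrom⇒fresh v [] vs legal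
  ... | fresh , unique = All∉∷⇒All≢ fresh ∷ unique

  -- prev lists the chosen vertices most recent first, so the full sequence is prev ʳ++ rs.
  -- Every step adds a fresh vertex, so prev stays duplicate-free and n steps of fuel suffice.
  greedyExtension : NoIsolated G → ∀ fuel prev → n < length prev + fuel → Unique prev →
                    ∃ λ rs → LegalFrom G prev rs × Dominates (prev ʳ++ rs)
  greedyExtension noIso fuel prev bound unique with dominates? prev
  greedyExtension noIso fuel prev bound unique | inj₁ dom =
    [] , tt , Dominates-mono (λ w∈prev → reverseAcc⁺ [] prev (inj₂ w∈prev)) dom
  greedyExtension noIso zero prev bound unique | inj₂ _ =
    ⊥-elim (≤⇒≯ (unique⇒length≤ unique) (subst (n <_) (+-identityʳ (length prev)) bound))
  greedyExtension noIso (suc fuel) prev bound unique | inj₂ (x , x-new) =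
    let y , xy = noIso x
        rs , legal , dom = greedyExtension noIso fuel (y ∷ prev)
                             (subst (n <_) (+-suc (length prev) fuel) bound)
                             (Unique-∷-fresh unique x-new (adj-sym xy))
    in y ∷ rs , LegalFrom-∷ prev x-new (adj-sym xy) legal , dom

  InClosedN⇒adjacent : ∀ {v w z} → Adj v w → InClosedN G v z → Adj z v ⊎ Adj z w
  InClosedN⇒adjacent vw (inj₁ refl) = inj₂ vw
  InClosedN⇒adjacent vw (inj₂ vz)   = inj₁ (adj-sym vz)

  inClosedN? : ∀ v z → Dec (InClosedN G v z)
  inClosedN? v z = (z ≟ᶠ v) ⊎-dec adj? v z

  outside? : ∀ v₁ v₂ z → Dec (Outside G v₁ v₂ z)
  outside? v₁ v₂ z = ¬? (inClosedN? v₁ z) ×-dec ¬? (inClosedN? v₂ z)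

  isolated⇒neighbours-adjacent : ∀ {v₁ v₂ u} → Adj v₁ v₂ →
    ¬ (∃ λ w → Outside G v₁ v₂ w × Adj u w) → ∀ z → Adj u z → Adj z v₁ ⊎ Adj z v₂
  isolated⇒neighbours-adjacent {v₁} {v₂} v₁v₂ isolated z uz
    with inClosedN? v₁ z | inClosedN? v₂ z
  ... | yes z∈N[v₁] | _           = InClosedN⇒adjacent v₁v₂ z∈N[v₁]
  ... | no _        | yes z∈N[v₂] = swap (InClosedN⇒adjacent (adj-sym v₁v₂) z∈N[v₂])
  ... | no z∉N[v₁]  | no z∉N[v₂]  = ⊥-elim (isolated (z , (z∉N[v₁] , z∉N[v₂]) , uz))

  TDSeq-longer-than-TDS : ∀ {v₁ v₂ u} → NoIsolated G → Adj v₁ v₂ → ¬ Adj v₁ u → ¬ Adj v₂ u →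
    (∀ z → Adj u z → Adj z v₁ ⊎ Adj z v₂) →
    ∃ λ vs → IsTDSeq G vs × ∃ λ A → IsTDS G A × ∣ A ∣ < length vs
  TDSeq-longer-than-TDS {v₁} {v₂} {u} noIso v₁v₂ v₁≁u v₂≁u u-neighbours-adjacent =
    vs , ((LegalFrom[]⇒Unique vs legal , legal) , dom) ,
    fromList others , Dominates⇒IsTDS (Dominates-drop dom dominatedByOthers) ,
    s≤s (∣fromList∣≤length others)
    where
    v₂-new : ¬ InSomeN G (u ∷ []) v₂
    v₂-new (here uv₂) = v₂≁u (adj-sym uv₂)

    v₁-new : ¬ InSomeN G (v₁ ∷ u ∷ []) v₁
    v₁-new (here v₁v₁)        = irrefl v₁v₁
    v₁-new (there (here uv₁)) = v₁≁u (adj-sym uv₁)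

    opening-unique : Unique (v₂ ∷ v₁ ∷ u ∷ [])
    opening-unique = Unique-∷-fresh (Unique-∷-fresh ([] ∷ []) v₂-new v₁v₂) v₁-new (adj-sym v₁v₂)

    extension : ∃ λ rs → LegalFrom G (v₂ ∷ v₁ ∷ u ∷ []) rs × Dominates (u ∷ v₁ ∷ v₂ ∷ rs)
    extension = greedyExtension noIso n (v₂ ∷ v₁ ∷ u ∷ []) (s≤s (m≤n+m n 2)) opening-unique

    rs others vs : List (Fin n)
    rs = proj₁ extension
    others = v₁ ∷ v₂ ∷ rs
    vs = u ∷ others

    legal : LegalFrom G [] vs
    legal = (v₂ , v₁v₂ , v₂-new) , (v₁ , adj-sym v₁v₂ , v₁-new) , proj₁ (proj₂ extension)

    dom : Dominates vs
    dom = proj₂ (proj₂ extension)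

    dominatedByOthers : ∀ z → Adj z u → DominatedBy others z
    dominatedByOthers z zu with u-neighbours-adjacent z (adj-sym zu)
    ... | inj₁ zv₁ = v₁ , here refl , zv₁
    ... | inj₂ zv₂ = v₂ , there (here refl) , zv₂

lemma2p1 : (n k : ℕ) → 2 ≤ k → (G : Graph n) → TotalUniform G k →
    (v₁ v₂ : Fin n) → Graph.Adj G v₁ v₂ → DeletionNoIsolated G v₁ v₂
lemma2p1 n k _ G (noIso , (_ , γt-minimal) , (_ , γgr-maximal)) v₁ v₂ v₁v₂ u (u∉N[v₁] , u∉N[v₂]) =
  decidable-stable (any? λ w → outside? G v₁ v₂ w ×-dec Graph.adj? G u w) λ isolated →
    let vs , vs-tdseq , A , A-tds , ∣A∣<∣vs∣ =
          TDSeq-longer-than-TDS G noIso v₁v₂ (u∉N[v₁] ∘ inj₂) (u∉N[v₂] ∘ inj₂)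
            (isolated⇒neighbours-adjacent G v₁v₂ isolated)
    in <⇒≱ ∣A∣<∣vs∣ (≤-trans (γgr-maximal vs vs-tdseq) (γt-minimal A A-tds))
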